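{- Let $\Delta$ be a bi-transitive bipartite digraph in which every vertex has at least one out-neighbour. Let $u,v,w$ be vertices of $\Delta$ such that $u$ and $v$ have the same colour and have no common out-neighbour. Then $u$ and $v$ are not both strongly connected to $w$ (that is, at least one of $u,v$ admits no directed walk to $w$).
   Context: Digraphs have no loops or multiple edges. A bipartite digraph has two colour classes with every edge joining different classes; it is bi-transitive if whenever $u_1v_1,v_1u_2,u_2v_2$ are edges, $u_1v_2$ is an edge. For vertices $x,y$, $x$ is strongly connected to $y$ if there is a directed walk $x=x_0\to x_1\to\cdots\to x_k=y$ with $k\ge1$ and each $x_ix_{i+1}$ an edge. -}

module Defs where

open import Level using (Level; _⊔_; suc)
open import Data.Bool using (Bool)
open import Data.Product using (∃; _×_)
open import Relation.Binary.PropositionalEquality using (_≡_)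
open import Relation.Nullary using (¬_)

-- A digraph on vertex set V: an edge relation E with no loops.
-- (No multiple edges is automatic: E x y is a relation.)
record Digraph {a} (V : Set a) ℓ : Set (a ⊔ Level.suc ℓ) where
  field
    E       : V → V → Set ℓ
    loopless : ∀ x → ¬ E x x

record BipartiteDigraph {a} (V : Set a) ℓ : Set (a ⊔ Level.suc ℓ) where
  field
    digraph : Digraph V ℓ
    colour  : V → Bool
    proper  : ∀ {x y} → Digraph.E digraph x y → ¬ (colour x ≡ colour y)
  open Digraph digraph public using (E; loopless)

module _ {a ℓ} {V : Set a} (Δ : BipartiteDigraph V ℓ) where
  open BipartiteDigraph Δ

  BiTransitive : Set (a ⊔ ℓ)
  BiTransitive = ∀ {u₁ v₁ u₂ v₂} → E u₁ v₁ → E v₁ u₂ → E u₂ v₂ → E u₁ v₂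

  NoSinks : Set (a ⊔ ℓ)
  NoSinks = ∀ x → ∃ λ y → E x y

  data StronglyConnectedTo : V → V → Set (a ⊔ ℓ) where
    step : ∀ {x y} → E x y → StronglyConnectedTo x y
    _∷_  : ∀ {x y z} → E x y → StronglyConnectedTo y z → StronglyConnectedTo x z

  CommonOutNeighbour : V → V → Set (a ⊔ ℓ)
  CommonOutNeighbour u v = ∃ λ x → E u x × E v x

-- By bi-transitivity every walk collapses to a walk of length one or two, so by
-- parity a walk from x to y is a single edge when x and y have different colours,
-- and a 2-path when they have the same colour; in the latter case x is joined to
-- every out-neighbour of y. If u and v both reach w, either w itself or (when w
-- has the colour of u and v) any out-neighbour of w is a common out-neighbour.
module Submission where

open import Defs
open import Level using (_⊔_)
open import Data.Bool using (Bool; _≟_)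
open import Data.Bool.Properties using (¬-not)
open import Data.Product using (_×_; _,_; ∃)
open import Data.Sum using (_⊎_; inj₁; inj₂)
open import Relation.Binary.PropositionalEquality using (_≡_; _≢_; trans; sym; ≢-sym)
open import Function using (_∘_)
open import Relation.Nullary using (¬_; yes; no; contradiction)

≢-≢⇒≡ : {x y z : Bool} → x ≢ y → y ≢ z → x ≡ z
≢-≢⇒≡ x≢y y≢z = trans (¬-not x≢y) (sym (¬-not (≢-sym y≢z)))

module _ {a ℓ} {V : Set a} (Δ : BipartiteDigraph V ℓ) where
  open BipartiteDigraph Δ

  Path₂ : V → V → Set (a ⊔ ℓ)
  Path₂ x y = ∃ λ m → E x m × E m y

  path₂⇒sameColour : ∀ {x y} → Path₂ x y → colour x ≡ colour y
  path₂⇒sameColour (_ , e , f) = ≢-≢⇒≡ (proper e) (proper f)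

  module _ (bt : BiTransitive Δ) where

    walk⇒edge⊎path₂ : ∀ {x y} → StronglyConnectedTo Δ x y → E x y ⊎ Path₂ x y
    walk⇒edge⊎path₂ (step e) = inj₁ e
    walk⇒edge⊎path₂ (e ∷ p) with walk⇒edge⊎path₂ p
    ... | inj₁ f           = inj₂ (_ , e , f)
    ... | inj₂ (_ , f , g) = inj₁ (bt e f g)

    walk⇒edge : ∀ {x y} → StronglyConnectedTo Δ x y → colour x ≢ colour y → E x y
    walk⇒edge p x≢y with walk⇒edge⊎path₂ p
    ... | inj₁ e  = e
    ... | inj₂ xy = contradiction (path₂⇒sameColour xy) x≢y

    walk⇒edge-toSuccessor : ∀ {x y z} → StronglyConnectedTo Δ x y →
                            colour x ≡ colour y → E y z → E x z
    walk⇒edge-toSuccessor p x≡y g with walk⇒edge⊎path₂ p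
    ... | inj₁ e           = contradiction x≡y (proper e)
    ... | inj₂ (_ , e , f) = bt e f g

lemma8 : ∀ {a ℓ} {V : Set a} (Δ : BipartiteDigraph V ℓ) →
    BiTransitive Δ → NoSinks Δ →
    (u v w : V) →
    BipartiteDigraph.colour Δ u ≡ BipartiteDigraph.colour Δ v →
    ¬ CommonOutNeighbour Δ u v →
    ¬ (StronglyConnectedTo Δ u w × StronglyConnectedTo Δ v w)
lemma8 Δ bt noSinks u v w u≡v noCommon (u⇝w , v⇝w)
  with BipartiteDigraph.colour Δ u ≟ BipartiteDigraph.colour Δ w
... | no u≢w = noCommon (w , walk⇒edge Δ bt u⇝w u≢w , walk⇒edge Δ bt v⇝w (u≢w ∘ trans u≡v))
... | yes u≡w with noSinks w
...   | z , w→z = noCommon (z , walk⇒edge-toSuccessor Δ bt u⇝w u≡w w→z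
                              , walk⇒edge-toSuccessor Δ bt v⇝w (trans (sym u≡v) u≡w) w→z)
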